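{- Let $G_\sigma$ be a connected signed graph with no positive cycles and at least two vertices. Then: (a) $G_\sigma$ is sign connected if and only if it has a cycle. (b) If $G_\sigma$ has exactly one cycle, then every edge is a sign isthmus. (c) If $G_\sigma$ has at least two cycles, then an edge is a sign isthmus if and only if it is an isthmus.
   Context: A signed graph consists of a finite undirected graph, in which loops and multiple edges are allowed, with a sign $\pm1$ on each edge. Cycles are elementary; a loop is a cycle of length 1. Chains are walks. The sign of a cycle or chain is the product of its edge signs, counted with multiplicity. Vertices $x,y$ are sign connected if $x=y$ or both a positive and a negative chain join them. The signed graph is sign connected if every two vertices are sign connected. For a sign-connected $G_\sigma$, an edge $e$ is a sign isthmus if $G_\sigma-e$ is not sign connected. An isthmus is an edge whose deletion increases the number of connected components. -}

module Defs where

open import Data.Nat using (ℕ)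
open import Data.Fin using (Fin)
open import Data.List using (List; []; _∷_; length; lookup; removeAt)
open import Data.List.Membership.Propositional using (_∈_)
open import Data.List.Relation.Unary.Unique.Propositional using (Unique)
open import Data.Sign using (Sign) renaming (_*_ to _*ₛ_)
open import Data.Product using (Σ; ∃; _×_; _,_)
open import Data.Sum using (_⊎_)
open import Relation.Binary.PropositionalEquality using (_≡_)
open import Relation.Nullary using (¬_)
open import Function.Bundles using (_⇔_)

record Edge (n : ℕ) : Set where
  constructor edge
  field
    end₁ : Fin n
    end₂ : Fin n
    sgn  : Sign
open Edge public

-- A signed graph on vertex set Fin n: a finite list of edges (loops and
-- multiple edges allowed).  Edges are identified by their position
-- Fin (length G) in the list.
SignedGraph : ℕ → Set
SignedGraph n = List (Edge n)

EdgeOf : ∀ {n} → SignedGraph n → Set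
EdgeOf G = Fin (length G)

_─_ : ∀ {n} (G : SignedGraph n) → EdgeOf G → SignedGraph n
G ─ e = removeAt G e

Joins : ∀ {n} (G : SignedGraph n) → EdgeOf G → Fin n → Fin n → Set
Joins G e x y =
  (end₁ (lookup G e) ≡ x × end₂ (lookup G e) ≡ y) ⊎
  (end₁ (lookup G e) ≡ y × end₂ (lookup G e) ≡ x)

data Chain {n} (G : SignedGraph n) : Fin n → Fin n → Set where
  []  : ∀ {x} → Chain G x x
  _∷⟨_⟩_ : ∀ {x y z} (e : EdgeOf G) → Joins G e x y → Chain G y z → Chain G x z

edges : ∀ {n} {G : SignedGraph n} {x y} → Chain G x y → List (EdgeOf G)
edges []               = []
edges (e ∷⟨ _ ⟩ w)     = e ∷ edges w

-- Vertices at which the successive edges start (the final vertex is omitted).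
verts : ∀ {n} {G : SignedGraph n} {x y} → Chain G x y → List (Fin n)
verts {x = x} []           = []
verts {x = x} (e ∷⟨ _ ⟩ w) = x ∷ verts w

chainSign : ∀ {n} {G : SignedGraph n} {x y} → Chain G x y → Sign
chainSign []                 = Sign.+
chainSign {G = G} (e ∷⟨ _ ⟩ w) = sgn (lookup G e) *ₛ chainSign w

-- A loop is a
-- cycle of length 1; two parallel edges form a cycle of length 2.
record Cycle {n} (G : SignedGraph n) : Set where
  field
    base   : Fin n
    walk   : Chain G base base
    nonempty : ¬ (edges walk ≡ [])
    edgesDistinct : Unique (edges walk)
    vertsDistinct : Unique (verts walk)
open Cycle public

cycleSign : ∀ {n} {G : SignedGraph n} → Cycle G → Sign
cycleSign C = chainSign (walk C)

-- Cycles are identified with their edge sets.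
SameCycle : ∀ {n} {G : SignedGraph n} → Cycle G → Cycle G → Set
SameCycle {G = G} C D = ∀ (e : EdgeOf G) → (e ∈ edges (walk C)) ⇔ (e ∈ edges (walk D))

HasCycle : ∀ {n} → SignedGraph n → Set
HasCycle G = Cycle G

ExactlyOneCycle : ∀ {n} → SignedGraph n → Set
ExactlyOneCycle G = Cycle G × (∀ (C D : Cycle G) → SameCycle C D)

AtLeastTwoCycles : ∀ {n} → SignedGraph n → Set
AtLeastTwoCycles G = Σ (Cycle G) λ C → Σ (Cycle G) λ D → ¬ SameCycle C D

NoPositiveCycle : ∀ {n} → SignedGraph n → Set
NoPositiveCycle G = ∀ (C : Cycle G) → cycleSign C ≡ Sign.-

Connected : ∀ {n} → SignedGraph n → Set
Connected {n} G = ∀ (x y : Fin n) → Chain G x y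

SignConnectedPair : ∀ {n} → SignedGraph n → Fin n → Fin n → Set
SignConnectedPair G x y =
  x ≡ y ⊎
  ((Σ (Chain G x y) λ w → chainSign w ≡ Sign.+) ×
   (Σ (Chain G x y) λ w → chainSign w ≡ Sign.-))

SignConnected : ∀ {n} → SignedGraph n → Set
SignConnected {n} G = ∀ (x y : Fin n) → SignConnectedPair G x y

-- Sign isthmus (used for sign-connected G): G − e is not sign connected.
SignIsthmus : ∀ {n} (G : SignedGraph n) → EdgeOf G → Set
SignIsthmus G e = ¬ SignConnected (G ─ e)

-- Isthmus of a CONNECTED graph G: deleting e increases the number of
-- components (from 1), i.e. G − e is not connected.
Isthmus : ∀ {n} (G : SignedGraph n) → EdgeOf G → Set
Isthmus G e = ¬ Connected (G ─ e)

module Submission where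

-- Two facts about chains carry the proof.  They are stated for an arbitrary
-- signature t (a sign on every edge, not only the graph's own signs):
--   * cycle extraction: a closed chain that is negative under t contains a
--     cycle, negative under t, made of edges of the chain;
--   * detours: going out to a negative closed chain, around it and back
--     reverses the sign of any chain, so a connected graph containing a
--     negative closed chain is sign connected.
-- Extraction under the indicator signature of an edge f (negative on f only)
-- locates cycles through or avoiding given edges; in particular two different
-- cycles through e produce a cycle avoiding e.

open import Defs
open import Data.Nat using (ℕ; suc; _≤_; s≤s; z≤n)
open import Data.Fin using (Fin; zero; suc; _≟_)
open import Data.Fin.Properties using (suc-injective; ¬∀⟶∃¬)
open import Data.List using (List; []; _∷_; _++_; length; lookup; removeAt)
open import Data.List.Membership.Propositional using (_∈_; _∉_)
open import Data.List.Membership.Propositional.Properties using (∈-++⁻)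
open import Data.List.Relation.Unary.Any using (here; there)
open import Data.List.Relation.Unary.All using (_∷_) renaming (lookup to All-lookup)
open import Data.List.Relation.Unary.All.Properties using (++⁻ˡ; ++⁻ʳ; ¬Any⇒All¬)
open import Data.List.Relation.Unary.AllPairs using ([]; _∷_)
open import Data.List.Relation.Unary.Unique.Propositional using (Unique)
open import Data.List.Relation.Unary.Unique.Propositional.Properties using (Unique[x∷xs]⇒x∉xs)
open import Data.List.Relation.Binary.Subset.Propositional using (_⊆_)
open import Data.List.Relation.Binary.Subset.Propositional.Properties
  using (⊆-reflexive; ⊆-trans; xs⊆xs++ys; xs⊆ys++xs; ∷⁺ʳ)
open import Data.Sign using (Sign; opposite) renaming (_*_ to _*ₛ_)
open import Data.Sign.Properties using (s*s≡+; *-identityʳ; *-assoc; *-comm)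
open import Data.Product using (Σ-syntax; ∃-syntax; _×_; _,_; proj₁; proj₂)
open import Data.Sum using (_⊎_; inj₁; inj₂; map₂)
open import Data.Empty using (⊥-elim)
open import Function using (_∘_; const)
open import Function.Bundles using (_⇔_; mk⇔; Equivalence)
open import Relation.Nullary using (¬_; yes; no)
open import Relation.Nullary.Decidable using (_×-dec_; _→-dec_)
open import Relation.Binary.PropositionalEquality
  using (_≡_; _≢_; refl; sym; trans; cong; cong₂; subst; module ≡-Reasoning)
open ≡-Reasoning

module _ {A : Set} where

  unique-++⁻ˡ : ∀ (xs : List A) {ys} → Unique (xs ++ ys) → Unique xs
  unique-++⁻ˡ []       _        = []
  unique-++⁻ˡ (x ∷ xs) (x∉ ∷ u) = ++⁻ˡ xs x∉ ∷ unique-++⁻ˡ xs u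

  unique-++⁻ʳ : ∀ (xs : List A) {ys} → Unique (xs ++ ys) → Unique ys
  unique-++⁻ʳ []       u       = u
  unique-++⁻ʳ (x ∷ xs) (_ ∷ u) = unique-++⁻ʳ xs u

  unique-++-disjoint : ∀ (xs : List A) {ys z} → Unique (xs ++ ys) → z ∈ xs → z ∉ ys
  unique-++-disjoint (x ∷ xs) (x∉ ∷ _) (here refl) z∈ys = All-lookup (++⁻ʳ xs x∉) z∈ys refl
  unique-++-disjoint (x ∷ xs) (_ ∷ u)  (there z∈xs) = unique-++-disjoint xs u z∈xs

detour-opposite : ∀ a c → a *ₛ (Sign.- *ₛ (a *ₛ c)) ≡ opposite c
detour-opposite Sign.- Sign.- = refl
detour-opposite Sign.- Sign.+ = refl
detour-opposite Sign.+ Sign.- = refl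
detour-opposite Sign.+ Sign.+ = refl

distinctVertices : ∀ {n} → 2 ≤ n → Σ[ x ∈ Fin n ] Σ[ y ∈ Fin n ] x ≢ y
distinctVertices (s≤s (s≤s z≤n)) = zero , suc zero , λ ()

module Walks {n : ℕ} (G : SignedGraph n) where

  Signature : Set
  Signature = EdgeOf G → Sign

  edgeSign : Signature
  edgeSign e = sgn (lookup G e)

  sign[_] : Signature → ∀ {x y} → Chain G x y → Sign
  sign[ t ] []           = Sign.+
  sign[ t ] (e ∷⟨ _ ⟩ w) = t e *ₛ sign[ t ] w

  chainSign≡sign : ∀ {x y} (w : Chain G x y) → chainSign w ≡ sign[ edgeSign ] w
  chainSign≡sign []           = refl
  chainSign≡sign (e ∷⟨ _ ⟩ w) = cong (edgeSign e *ₛ_) (chainSign≡sign w)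

  infixr 5 _++ᶜ_
  _++ᶜ_ : ∀ {x y z} → Chain G x y → Chain G y z → Chain G x z
  []           ++ᶜ v = v
  (e ∷⟨ j ⟩ w) ++ᶜ v = e ∷⟨ j ⟩ (w ++ᶜ v)

  edges-++ᶜ : ∀ {x y z} (w : Chain G x y) (v : Chain G y z) → edges (w ++ᶜ v) ≡ edges w ++ edges v
  edges-++ᶜ []           v = refl
  edges-++ᶜ (e ∷⟨ _ ⟩ w) v = cong (e ∷_) (edges-++ᶜ w v)

  verts-++ᶜ : ∀ {x y z} (w : Chain G x y) (v : Chain G y z) → verts (w ++ᶜ v) ≡ verts w ++ verts v
  verts-++ᶜ           []           v = refl
  verts-++ᶜ {x = x} (e ∷⟨ _ ⟩ w) v = cong (x ∷_) (verts-++ᶜ w v)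

  sign-++ᶜ : ∀ t {x y z} (w : Chain G x y) (v : Chain G y z) →
             sign[ t ] (w ++ᶜ v) ≡ sign[ t ] w *ₛ sign[ t ] v
  sign-++ᶜ t []           v = refl
  sign-++ᶜ t (e ∷⟨ _ ⟩ w) v =
    trans (cong (t e *ₛ_) (sign-++ᶜ t w v)) (sym (*-assoc (t e) _ _))

  edges-++ᶜ-⊆ˡ : ∀ {x y z} (w : Chain G x y) (v : Chain G y z) → edges w ⊆ edges (w ++ᶜ v)
  edges-++ᶜ-⊆ˡ w v = ⊆-trans (xs⊆xs++ys (edges w) (edges v)) (⊆-reflexive (sym (edges-++ᶜ w v)))

  edges-++ᶜ-⊆ʳ : ∀ {x y z} (w : Chain G x y) (v : Chain G y z) → edges v ⊆ edges (w ++ᶜ v)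
  edges-++ᶜ-⊆ʳ w v = ⊆-trans (xs⊆ys++xs (edges v) (edges w)) (⊆-reflexive (sym (edges-++ᶜ w v)))

  verts-++ᶜ-⊆ʳ : ∀ {x y z} (w : Chain G x y) (v : Chain G y z) → verts v ⊆ verts (w ++ᶜ v)
  verts-++ᶜ-⊆ʳ w v = ⊆-trans (xs⊆ys++xs (verts v) (verts w)) (⊆-reflexive (sym (verts-++ᶜ w v)))

  ∈-edges-++ᶜ⁻ : ∀ {f x y z} (w : Chain G x y) (v : Chain G y z) →
                 f ∈ edges (w ++ᶜ v) → f ∈ edges w ⊎ f ∈ edges v
  ∈-edges-++ᶜ⁻ w v = ∈-++⁻ (edges w) ∘ ⊆-reflexive (edges-++ᶜ w v)

  joins-sym : ∀ {e x y} → Joins G e x y → Joins G e y x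
  joins-sym (inj₁ (p , q)) = inj₂ (p , q)
  joins-sym (inj₂ (p , q)) = inj₁ (p , q)

  reverseᶜ : ∀ {x y} → Chain G x y → Chain G y x
  reverseᶜ []           = []
  reverseᶜ (e ∷⟨ j ⟩ w) = reverseᶜ w ++ᶜ (e ∷⟨ joins-sym j ⟩ [])

  sign-reverseᶜ : ∀ t {x y} (w : Chain G x y) → sign[ t ] (reverseᶜ w) ≡ sign[ t ] w
  sign-reverseᶜ t []           = refl
  sign-reverseᶜ t (e ∷⟨ j ⟩ w) = begin
    sign[ t ] (reverseᶜ w ++ᶜ (e ∷⟨ joins-sym j ⟩ [])) ≡⟨ sign-++ᶜ t (reverseᶜ w) _ ⟩
    sign[ t ] (reverseᶜ w) *ₛ (t e *ₛ Sign.+)          ≡⟨ cong₂ _*ₛ_ (sign-reverseᶜ t w) (*-identityʳ (t e)) ⟩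
    sign[ t ] w *ₛ t e                                 ≡⟨ *-comm (sign[ t ] w) (t e) ⟩
    t e *ₛ sign[ t ] w                                 ∎

  edges-reverseᶜ-⊆ : ∀ {x y} (w : Chain G x y) → edges (reverseᶜ w) ⊆ edges w
  edges-reverseᶜ-⊆ (e ∷⟨ j ⟩ w) f∈ with ∈-edges-++ᶜ⁻ (reverseᶜ w) _ f∈
  ... | inj₁ f∈w    = there (edges-reverseᶜ-⊆ w f∈w)
  ... | inj₂ (here p) = here p

  joins-orientation : ∀ {e a c a′ c′} → Joins G e a c → Joins G e a′ c′ →
                      (a′ ≡ a × c′ ≡ c) ⊎ (a′ ≡ c × c′ ≡ a)
  joins-orientation (inj₁ (p , q)) (inj₁ (r , s)) = inj₁ (trans (sym r) p , trans (sym s) q)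
  joins-orientation (inj₁ (p , q)) (inj₂ (r , s)) = inj₂ (trans (sym s) q , trans (sym r) p)
  joins-orientation (inj₂ (p , q)) (inj₁ (r , s)) = inj₂ (trans (sym r) p , trans (sym s) q)
  joins-orientation (inj₂ (p , q)) (inj₂ (r , s)) = inj₁ (trans (sym s) q , trans (sym r) p)

  joins-back : ∀ {e x y z} → Joins G e x y → Joins G e y z → z ≡ x
  joins-back j k with joins-orientation j k
  ... | inj₁ (y≡x , z≡y) = trans z≡y y≡x
  ... | inj₂ (_ , z≡x)   = z≡x

  -- The indicator signature of f: negative on f, positive elsewhere.  Its
  -- sign on a chain detects whether f is used (once).
  indicator : EdgeOf G → Signature
  indicator f g with f ≟ g
  ... | yes _ = Sign.-
  ... | no  _ = Sign.+

  indicator-self : ∀ f → indicator f f ≡ Sign.-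
  indicator-self f with f ≟ f
  ... | yes _   = refl
  ... | no  f≢f = ⊥-elim (f≢f refl)

  indicator-other : ∀ f g → f ≢ g → indicator f g ≡ Sign.+
  indicator-other f g f≢g with f ≟ g
  ... | yes f≡g = ⊥-elim (f≢g f≡g)
  ... | no  _   = refl

  indicator-avoid : ∀ f {x y} (w : Chain G x y) → f ∉ edges w → sign[ indicator f ] w ≡ Sign.+
  indicator-avoid f []           _   = refl
  indicator-avoid f (g ∷⟨ _ ⟩ w) f∉ = begin
    indicator f g *ₛ sign[ indicator f ] w ≡⟨ cong₂ _*ₛ_ (indicator-other f g (f∉ ∘ here))
                                                          (indicator-avoid f w (f∉ ∘ there)) ⟩
    Sign.+                                 ∎

  indicator-once : ∀ f {x y} (w : Chain G x y) → Unique (edges w) → f ∈ edges w →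
                   sign[ indicator f ] w ≡ Sign.-
  indicator-once f (g ∷⟨ _ ⟩ w) u (here refl) =
    cong₂ _*ₛ_ (indicator-self f) (indicator-avoid f w (Unique[x∷xs]⇒x∉xs u))
  indicator-once f (g ∷⟨ _ ⟩ w) (g∉ ∷ u) (there f∈w) =
    cong₂ _*ₛ_ (indicator-other f g (λ f≡g → All-lookup g∉ f∈w (sym f≡g))) (indicator-once f w u f∈w)

  indicator-negative⇒∈ : ∀ f {x y} (w : Chain G x y) → sign[ indicator f ] w ≡ Sign.- → f ∈ edges w
  indicator-negative⇒∈ f (g ∷⟨ _ ⟩ w) neg with f ≟ g
  ... | yes f≡g = here f≡g
  ... | no  _   = there (indicator-negative⇒∈ f w neg)

  OnChain : ∀ {x y} → Chain G x y → Fin n → Set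
  OnChain {y = y} p v = v ∈ verts p ⊎ v ≡ y

  start-on : ∀ {x y} (p : Chain G x y) → OnChain p x
  start-on []           = inj₂ refl
  start-on (_ ∷⟨ _ ⟩ _) = inj₁ (here refl)

  on-tail : ∀ {e x y z v} {j : Joins G e x y} (p : Chain G y z) → OnChain p v → OnChain (e ∷⟨ j ⟩ p) v
  on-tail p (inj₁ v∈p) = inj₁ (there v∈p)
  on-tail p (inj₂ v≡z) = inj₂ v≡z

  joined-on : ∀ {f a b x y} (p : Chain G x y) → f ∈ edges p → Joins G f a b → OnChain p b
  joined-on (f ∷⟨ k ⟩ p) (here refl) j with joins-orientation k j
  ... | inj₁ (_ , refl) = on-tail {j = k} p (start-on p)
  ... | inj₂ (_ , refl) = inj₁ (here refl)
  joined-on (g ∷⟨ k ⟩ p) (there f∈p) j = on-tail {j = k} p (joined-on p f∈p j)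

  locate : ∀ v {x y} (p : Chain G x y) →
           ¬ OnChain p v ⊎ Σ[ p₁ ∈ Chain G x v ] Σ[ p₂ ∈ Chain G v y ] (p ≡ p₁ ++ᶜ p₂ × v ∉ verts p₁)
  locate v {x} [] with v ≟ x
  ... | yes refl = inj₂ ([] , [] , refl , λ ())
  ... | no  v≢x  = inj₁ λ { (inj₁ ()) ; (inj₂ v≡x) → v≢x v≡x }
  locate v {x} (e ∷⟨ j ⟩ p) with v ≟ x
  ... | yes refl = inj₂ ([] , e ∷⟨ j ⟩ p , refl , λ ())
  ... | no  v≢x with locate v p
  ...   | inj₁ off = inj₁ λ { (inj₁ (here v≡x)) → v≢x v≡x
                            ; (inj₁ (there v∈p)) → off (inj₁ v∈p)
                            ; (inj₂ v≡y) → off (inj₂ v≡y) }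
  ...   | inj₂ (p₁ , p₂ , p≡ , fresh) =
          inj₂ (e ∷⟨ j ⟩ p₁ , p₂ , cong (e ∷⟨ j ⟩_) p≡
               , λ { (here v≡x) → v≢x v≡x ; (there v∈p₁) → fresh v∈p₁ })

  record IsPath {x y} (p : Chain G x y) : Set where
    constructor isPath
    field
      vertsUnique : Unique (verts p)
      endFresh    : y ∉ verts p
      edgesUnique : Unique (edges p)

  path-∷ : ∀ {e x y z} (j : Joins G e x y) {p : Chain G y z} → IsPath p → ¬ OnChain p x →
           IsPath (e ∷⟨ j ⟩ p)
  path-∷ j {p} (isPath vu ef eu) off = isPath
    (¬Any⇒All¬ _ (off ∘ inj₁) ∷ vu)
    (λ { (here z≡x) → off (inj₂ (sym z≡x)) ; (there z∈p) → ef z∈p })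
    (¬Any⇒All¬ _ (λ e∈p → off (joined-on p e∈p (joins-sym j))) ∷ eu)

  path-++ˡ : ∀ {x v y} (p₁ : Chain G x v) (p₂ : Chain G v y) → IsPath (p₁ ++ᶜ p₂) → v ∉ verts p₁ →
             IsPath p₁
  path-++ˡ p₁ p₂ (isPath vu _ eu) fresh = isPath
    (unique-++⁻ˡ (verts p₁) (subst Unique (verts-++ᶜ p₁ p₂) vu))
    fresh
    (unique-++⁻ˡ (edges p₁) (subst Unique (edges-++ᶜ p₁ p₂) eu))

  path-++ʳ : ∀ {x v y} (p₁ : Chain G x v) (p₂ : Chain G v y) → IsPath (p₁ ++ᶜ p₂) → IsPath p₂
  path-++ʳ p₁ p₂ (isPath vu ef eu) = isPath
    (unique-++⁻ʳ (verts p₁) (subst Unique (verts-++ᶜ p₁ p₂) vu))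
    (ef ∘ verts-++ᶜ-⊆ʳ p₁ p₂)
    (unique-++⁻ʳ (edges p₁) (subst Unique (edges-++ᶜ p₁ p₂) eu))

  -- A path from x to x is empty, hence positive.
  closedPath-positive : ∀ t {x} (q : Chain G x x) → x ∉ verts q → sign[ t ] q ≡ Sign.+
  closedPath-positive t []           _  = refl
  closedPath-positive t (_ ∷⟨ _ ⟩ _) x∉ = ⊥-elim (x∉ (here refl))

  -- If a path q from y back to x uses the edge e from x to y, then q merely
  -- crosses e back, and the closed chain e q is positive under every signature.
  retrace-positive : ∀ t {e x y} (j : Joins G e x y) (q : Chain G y x) → IsPath q → e ∈ edges q →
                     sign[ t ] (e ∷⟨ j ⟩ q) ≡ Sign.+
  retrace-positive t {e} j (f ∷⟨ k ⟩ q) (isPath _ ef _) (here refl) with joins-back j k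
  ... | refl = begin
    t e *ₛ (t e *ₛ sign[ t ] q) ≡⟨ cong (λ s → t e *ₛ (t e *ₛ s)) (closedPath-positive t q (ef ∘ there)) ⟩
    t e *ₛ (t e *ₛ Sign.+)      ≡⟨ cong (t e *ₛ_) (*-identityʳ (t e)) ⟩
    t e *ₛ t e                  ≡⟨ s*s≡+ (t e) ⟩
    Sign.+                      ∎
  retrace-positive t j (f ∷⟨ k ⟩ q) (isPath vu ef _) (there e∈q) with joined-on q e∈q j
  ... | inj₁ y∈q = ⊥-elim (Unique[x∷xs]⇒x∉xs vu y∈q)
  ... | inj₂ y≡x = ⊥-elim (ef (here (sym y≡x)))

  close-cycle : ∀ t {e x y} (j : Joins G e x y) (q : Chain G y x) → IsPath q →
                sign[ t ] (e ∷⟨ j ⟩ q) ≡ Sign.- → Cycle G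
  close-cycle t {e} {x} j q pq neg = record
    { base = x ; walk = e ∷⟨ j ⟩ q ; nonempty = λ ()
    ; edgesDistinct = ¬Any⇒All¬ _ e∉q ∷ IsPath.edgesUnique pq
    ; vertsDistinct = ¬Any⇒All¬ _ (IsPath.endFresh pq) ∷ IsPath.vertsUnique pq }
    where
      e∉q : e ∉ edges q
      e∉q e∈q with trans (sym (retrace-positive t j q pq e∈q)) neg
      ... | ()

  record PathWith (t : Signature) (x y : Fin n) (s : Sign) (es : List (EdgeOf G)) : Set where
    constructor pathWith
    field
      path   : Chain G x y
      isP    : IsPath path
      signIs : sign[ t ] path ≡ s
      within : edges path ⊆ es

  NegativeCycleWithin : Signature → List (EdgeOf G) → Set
  NegativeCycleWithin t es = Σ[ C ∈ Cycle G ] (sign[ t ] (walk C) ≡ Sign.- × edges (walk C) ⊆ es)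

  -- One step of extraction: prefix a path by an edge from x.  If x is off the
  -- path this is a longer path; otherwise the edge closes a loop, which is a
  -- cycle when t-negative and can be cut out without changing the sign when
  -- t-positive.
  extend : ∀ t {e x y z s es} (j : Joins G e x y) → PathWith t y z s es →
           NegativeCycleWithin t (e ∷ es) ⊎ PathWith t x z (t e *ₛ s) (e ∷ es)
  extend t {e} {x} j (pathWith p pp refl p⊆) with locate x p
  ... | inj₁ off = inj₂ (pathWith (e ∷⟨ j ⟩ p) (path-∷ j pp off) refl (∷⁺ʳ e p⊆))
  ... | inj₂ (p₁ , p₂ , refl , fresh) with sign[ t ] (e ∷⟨ j ⟩ p₁) in loop
  ...   | Sign.- = inj₁ ( close-cycle t j p₁ (path-++ˡ p₁ p₂ pp fresh) loop , loop
                        , ∷⁺ʳ e (p⊆ ∘ edges-++ᶜ-⊆ˡ p₁ p₂))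
  ...   | Sign.+ = inj₂ (pathWith p₂ (path-++ʳ p₁ p₂ pp) loopRemoved (there ∘ p⊆ ∘ edges-++ᶜ-⊆ʳ p₁ p₂))
    where
      loopRemoved : sign[ t ] p₂ ≡ t e *ₛ sign[ t ] (p₁ ++ᶜ p₂)
      loopRemoved = sym (begin
        t e *ₛ sign[ t ] (p₁ ++ᶜ p₂)           ≡⟨ cong (t e *ₛ_) (sign-++ᶜ t p₁ p₂) ⟩
        t e *ₛ (sign[ t ] p₁ *ₛ sign[ t ] p₂)  ≡⟨ sym (*-assoc (t e) _ _) ⟩
        (t e *ₛ sign[ t ] p₁) *ₛ sign[ t ] p₂  ≡⟨ cong (_*ₛ sign[ t ] p₂) loop ⟩
        sign[ t ] p₂                           ∎)

  cycleOrPath : ∀ t {x y} (w : Chain G x y) →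
                NegativeCycleWithin t (edges w) ⊎ PathWith t x y (sign[ t ] w) (edges w)
  cycleOrPath t [] = inj₂ (pathWith [] (isPath [] (λ ()) []) refl (λ ()))
  cycleOrPath t (e ∷⟨ j ⟩ w) with cycleOrPath t w
  ... | inj₁ (C , neg , C⊆w) = inj₁ (C , neg , there ∘ C⊆w)
  ... | inj₂ P               = extend t j P

  -- Cycle extraction: a t-negative closed chain contains a t-negative cycle,
  -- since a closed path is empty and so positive.
  negativeCycleIn : ∀ t {b} (W : Chain G b b) → sign[ t ] W ≡ Sign.- → NegativeCycleWithin t (edges W)
  negativeCycleIn t W neg with cycleOrPath t W
  ... | inj₁ C = C
  ... | inj₂ (pathWith p pp p-sign _)
          with trans (sym (closedPath-positive t p (IsPath.endFresh pp))) (trans p-sign neg)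
  ...   | ()

  cycleIn : ∀ {b} (W : Chain G b b) → chainSign W ≡ Sign.- → Σ[ C ∈ Cycle G ] edges (walk C) ⊆ edges W
  cycleIn W neg with negativeCycleIn edgeSign W (trans (sym (chainSign≡sign W)) neg)
  ... | C , _ , C⊆W = C , C⊆W

  record EdgeSplit (e : EdgeOf G) {x y} (w : Chain G x y) : Set where
    constructor edgeSplit
    field
      {a c}    : Fin n
      before   : Chain G x a
      crossing : Joins G e a c
      after    : Chain G c y
      splits   : w ≡ before ++ᶜ (e ∷⟨ crossing ⟩ after)

  splitAt : ∀ {e x y} (w : Chain G x y) → e ∈ edges w → EdgeSplit e w
  splitAt (f ∷⟨ j ⟩ w) (here refl) = edgeSplit [] j w refl
  splitAt (f ∷⟨ j ⟩ w) (there e∈w) with splitAt w e∈w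
  ... | edgeSplit w₁ k w₂ w≡ = edgeSplit (f ∷⟨ j ⟩ w₁) k w₂ (cong (f ∷⟨ j ⟩_) w≡)

  record Opened (e : EdgeOf G) {b} (w : Chain G b b) : Set where
    constructor opened
    field
      {a c}    : Fin n
      crossing : Joins G e a c
      rest     : Chain G c a
      avoids   : e ∉ edges rest
      inside   : edges rest ⊆ edges w
      sameSign : ∀ t → t e ≡ Sign.+ → sign[ t ] rest ≡ sign[ t ] w

  openAt : ∀ {e b} (w : Chain G b b) → Unique (edges w) → e ∈ edges w → Opened e w
  openAt {e} w u e∈w with splitAt w e∈w
  ... | edgeSplit w₁ j w₂ refl = opened j (w₂ ++ᶜ w₁) avoids inside sameSign
    where
      u′ : Unique (edges w₁ ++ e ∷ edges w₂)
      u′ = subst Unique (edges-++ᶜ w₁ _) u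

      avoids : e ∉ edges (w₂ ++ᶜ w₁)
      avoids e∈ with ∈-edges-++ᶜ⁻ w₂ w₁ e∈
      ... | inj₁ e∈w₂ = Unique[x∷xs]⇒x∉xs (unique-++⁻ʳ (edges w₁) u′) e∈w₂
      ... | inj₂ e∈w₁ = unique-++-disjoint (edges w₁) u′ e∈w₁ (here refl)

      inside : edges (w₂ ++ᶜ w₁) ⊆ edges (w₁ ++ᶜ (e ∷⟨ j ⟩ w₂))
      inside f∈ with ∈-edges-++ᶜ⁻ w₂ w₁ f∈
      ... | inj₁ f∈w₂ = edges-++ᶜ-⊆ʳ w₁ _ (there f∈w₂)
      ... | inj₂ f∈w₁ = edges-++ᶜ-⊆ˡ w₁ _ f∈w₁

      sameSign : ∀ t → t e ≡ Sign.+ → sign[ t ] (w₂ ++ᶜ w₁) ≡ sign[ t ] (w₁ ++ᶜ (e ∷⟨ j ⟩ w₂))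
      sameSign t te = begin
        sign[ t ] (w₂ ++ᶜ w₁)                  ≡⟨ sign-++ᶜ t w₂ w₁ ⟩
        sign[ t ] w₂ *ₛ sign[ t ] w₁           ≡⟨ *-comm (sign[ t ] w₂) _ ⟩
        sign[ t ] w₁ *ₛ sign[ t ] w₂           ≡⟨ cong (λ s → sign[ t ] w₁ *ₛ (s *ₛ sign[ t ] w₂)) (sym te) ⟩
        sign[ t ] w₁ *ₛ (t e *ₛ sign[ t ] w₂)  ≡⟨ sym (sign-++ᶜ t w₁ (e ∷⟨ j ⟩ w₂)) ⟩
        sign[ t ] (w₁ ++ᶜ (e ∷⟨ j ⟩ w₂))       ∎

  glue : ∀ t {e a c a′ c′} → Joins G e a c → Joins G e a′ c′ → (r : Chain G c a) (r′ : Chain G c′ a′) →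
         Σ[ W ∈ Chain G c c ] (sign[ t ] W ≡ sign[ t ] r *ₛ sign[ t ] r′
                              × (∀ {g} → g ∈ edges W → g ∈ edges r ⊎ g ∈ edges r′))
  glue t j j′ r r′ with joins-orientation j j′
  ... | inj₁ (refl , refl) =
          r ++ᶜ reverseᶜ r′
        , trans (sign-++ᶜ t r (reverseᶜ r′)) (cong (sign[ t ] r *ₛ_) (sign-reverseᶜ t r′))
        , map₂ (edges-reverseᶜ-⊆ r′) ∘ ∈-edges-++ᶜ⁻ r (reverseᶜ r′)
  ... | inj₂ (refl , refl) = r ++ᶜ r′ , sign-++ᶜ t r r′ , ∈-edges-++ᶜ⁻ r r′

  -- Two cycles through e, where f lies on the first only, yield a cycle
  -- avoiding e: glue the two cycles opened at e; the result uses f exactly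
  -- once, so it is negative under the indicator of f and extraction applies.
  cycleAvoiding : ∀ {e f} (C D : Cycle G) → e ∈ edges (walk C) → e ∈ edges (walk D) →
                  f ∈ edges (walk C) → f ∉ edges (walk D) → Σ[ F ∈ Cycle G ] e ∉ edges (walk F)
  cycleAvoiding {e} {f} C D e∈C e∈D f∈C f∉D = F , e∉F
    where
      open Opened
      t : Signature
      t = indicator f

      te : t e ≡ Sign.+
      te = indicator-other f e λ { refl → f∉D e∈D }

      OC = openAt (walk C) (edgesDistinct C) e∈C
      OD = openAt (walk D) (edgesDistinct D) e∈D
      glued = glue t (crossing OC) (crossing OD) (rest OC) (rest OD)

      glued-negative : sign[ t ] (proj₁ glued) ≡ Sign.-
      glued-negative = begin
        sign[ t ] (proj₁ glued)                      ≡⟨ proj₁ (proj₂ glued) ⟩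
        sign[ t ] (rest OC) *ₛ sign[ t ] (rest OD)  ≡⟨ cong₂ _*ₛ_
            (trans (sameSign OC t te) (indicator-once f (walk C) (edgesDistinct C) f∈C))
            (trans (sameSign OD t te) (indicator-avoid f (walk D) f∉D)) ⟩
        Sign.-                                       ∎

      extracted = negativeCycleIn t (proj₁ glued) glued-negative
      F = proj₁ extracted

      e∉F : e ∉ edges (walk F)
      e∉F e∈F with proj₂ (proj₂ glued) (proj₂ (proj₂ extracted) e∈F)
      ... | inj₁ e∈C′ = avoids OC e∈C′
      ... | inj₂ e∈D′ = avoids OD e∈D′

  open import Data.List.Membership.DecPropositional (_≟_ {length G}) using (_∈?_)

  AgreeAt : Cycle G → Cycle G → EdgeOf G → Set
  AgreeAt C D f = (f ∈ edges (walk C) → f ∈ edges (walk D)) × (f ∈ edges (walk D) → f ∈ edges (walk C))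

  distinguishingEdge : ∀ (C D : Cycle G) → ¬ SameCycle C D →
    ∃[ f ] ((f ∈ edges (walk C) × f ∉ edges (walk D)) ⊎ (f ∈ edges (walk D) × f ∉ edges (walk C)))
  distinguishingEdge C D C≠D
    with ¬∀⟶∃¬ _ (AgreeAt C D) (λ f → (f ∈? edges (walk C) →-dec f ∈? edges (walk D))
                                      ×-dec (f ∈? edges (walk D) →-dec f ∈? edges (walk C)))
                 (λ agree → C≠D λ f → mk⇔ (proj₁ (agree f)) (proj₂ (agree f)))
  ... | f , disagree with f ∈? edges (walk C) | f ∈? edges (walk D)
  ...   | yes f∈C | yes f∈D = ⊥-elim (disagree (const f∈D , const f∈C))
  ...   | yes f∈C | no  f∉D = f , inj₁ (f∈C , f∉D)
  ...   | no  f∉C | yes f∈D = f , inj₂ (f∈D , f∉C)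
  ...   | no  f∉C | no  f∉D = ⊥-elim (disagree (⊥-elim ∘ f∉C , ⊥-elim ∘ f∉D))

  avoidingCycle : AtLeastTwoCycles G → ∀ e → Σ[ F ∈ Cycle G ] e ∉ edges (walk F)
  avoidingCycle (C , D , C≠D) e with e ∈? edges (walk C) | e ∈? edges (walk D)
  ... | no  e∉C | _       = C , e∉C
  ... | yes _   | no  e∉D = D , e∉D
  ... | yes e∈C | yes e∈D with distinguishingEdge C D C≠D
  ...   | f , inj₁ (f∈C , f∉D) = cycleAvoiding C D e∈C e∈D f∈C f∉D
  ...   | f , inj₂ (f∈D , f∉C) = cycleAvoiding D C e∈D e∈C f∈D f∉C

  oppositeChains⇒signConnected : ∀ {x y} (w v : Chain G x y) → chainSign v ≡ opposite (chainSign w) →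
                                 SignConnectedPair G x y
  oppositeChains⇒signConnected w v v-opp with chainSign w in w-sign
  ... | Sign.+ = inj₂ ((w , w-sign) , (v , v-opp))
  ... | Sign.- = inj₂ ((v , v-opp) , (w , w-sign))

  detour-sign : ∀ t {x b y} (q : Chain G x b) (W : Chain G b b) (w : Chain G x y) →
                sign[ t ] W ≡ Sign.- → sign[ t ] (q ++ᶜ W ++ᶜ reverseᶜ q ++ᶜ w) ≡ opposite (sign[ t ] w)
  detour-sign t q W w neg = begin
    sign[ t ] (q ++ᶜ W ++ᶜ reverseᶜ q ++ᶜ w)
      ≡⟨ sign-++ᶜ t q _ ⟩
    sign[ t ] q *ₛ sign[ t ] (W ++ᶜ reverseᶜ q ++ᶜ w)
      ≡⟨ cong (sign[ t ] q *ₛ_) (sign-++ᶜ t W _) ⟩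
    sign[ t ] q *ₛ (sign[ t ] W *ₛ sign[ t ] (reverseᶜ q ++ᶜ w))
      ≡⟨ cong (λ s → sign[ t ] q *ₛ (sign[ t ] W *ₛ s)) (sign-++ᶜ t (reverseᶜ q) w) ⟩
    sign[ t ] q *ₛ (sign[ t ] W *ₛ (sign[ t ] (reverseᶜ q) *ₛ sign[ t ] w))
      ≡⟨ cong₂ (λ s r → sign[ t ] q *ₛ (s *ₛ (r *ₛ sign[ t ] w))) neg (sign-reverseᶜ t q) ⟩
    sign[ t ] q *ₛ (Sign.- *ₛ (sign[ t ] q *ₛ sign[ t ] w))
      ≡⟨ detour-opposite (sign[ t ] q) (sign[ t ] w) ⟩
    opposite (sign[ t ] w) ∎

  negativeClosedChain⇒signConnected : Connected G → ∀ {b} (W : Chain G b b) →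
                                      chainSign W ≡ Sign.- → SignConnected G
  negativeClosedChain⇒signConnected conn {b} W neg x y =
    oppositeChains⇒signConnected w detour (begin
      chainSign detour                ≡⟨ chainSign≡sign detour ⟩
      sign[ edgeSign ] detour         ≡⟨ detour-sign edgeSign q W w (trans (sym (chainSign≡sign W)) neg) ⟩
      opposite (sign[ edgeSign ] w)   ≡⟨ cong opposite (sym (chainSign≡sign w)) ⟩
      opposite (chainSign w)          ∎)
    where
      q = conn x b
      w = conn x y
      detour = q ++ᶜ W ++ᶜ reverseᶜ q ++ᶜ w

  signConnected⇒chain : ∀ {x y} → SignConnectedPair G x y → Chain G x y
  signConnected⇒chain (inj₁ refl)            = []
  signConnected⇒chain (inj₂ ((w , _) , _)) = w

  negativeClosedChain : ∀ {x y} → x ≢ y → SignConnectedPair G x y →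
                        Σ[ W ∈ Chain G x x ] chainSign W ≡ Sign.-
  negativeClosedChain x≢y (inj₁ x≡y) = ⊥-elim (x≢y x≡y)
  negativeClosedChain x≢y (inj₂ ((wp , wp-sign) , (wm , wm-sign))) = wp ++ᶜ reverseᶜ wm , (begin
    chainSign (wp ++ᶜ reverseᶜ wm)                              ≡⟨ chainSign≡sign (wp ++ᶜ reverseᶜ wm) ⟩
    sign[ edgeSign ] (wp ++ᶜ reverseᶜ wm)                       ≡⟨ sign-++ᶜ edgeSign wp _ ⟩
    sign[ edgeSign ] wp *ₛ sign[ edgeSign ] (reverseᶜ wm)       ≡⟨ cong (sign[ edgeSign ] wp *ₛ_) (sign-reverseᶜ edgeSign wm) ⟩
    sign[ edgeSign ] wp *ₛ sign[ edgeSign ] wm                  ≡⟨ sym (cong₂ _*ₛ_ (chainSign≡sign wp) (chainSign≡sign wm)) ⟩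
    chainSign wp *ₛ chainSign wm                                ≡⟨ cong₂ _*ₛ_ wp-sign wm-sign ⟩
    Sign.-                                                      ∎)

open Walks

module _ {A : Set} where

  liftIndex : ∀ (xs : List A) e → Fin (length (removeAt xs e)) → Fin (length xs)
  liftIndex (x ∷ xs) zero    i       = suc i
  liftIndex (x ∷ xs) (suc e) zero    = zero
  liftIndex (x ∷ xs) (suc e) (suc i) = suc (liftIndex xs e i)

  liftIndex-lookup : ∀ (xs : List A) e i → lookup xs (liftIndex xs e i) ≡ lookup (removeAt xs e) i
  liftIndex-lookup (x ∷ xs) zero    i       = refl
  liftIndex-lookup (x ∷ xs) (suc e) zero    = refl
  liftIndex-lookup (x ∷ xs) (suc e) (suc i) = liftIndex-lookup xs e i

  liftIndex-≢ : ∀ (xs : List A) e i → liftIndex xs e i ≢ e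
  liftIndex-≢ (x ∷ xs) zero    i       ()
  liftIndex-≢ (x ∷ xs) (suc e) zero    ()
  liftIndex-≢ (x ∷ xs) (suc e) (suc i) p = liftIndex-≢ xs e i (suc-injective p)

  lowerIndex : ∀ (xs : List A) e f → f ≢ e → Fin (length (removeAt xs e))
  lowerIndex (x ∷ xs) zero    zero    f≢e = ⊥-elim (f≢e refl)
  lowerIndex (x ∷ xs) zero    (suc f) _   = f
  lowerIndex (x ∷ xs) (suc e) zero    _   = zero
  lowerIndex (x ∷ xs) (suc e) (suc f) f≢e = suc (lowerIndex xs e f (f≢e ∘ cong suc))

  lowerIndex-lookup : ∀ (xs : List A) e f (f≢e : f ≢ e) →
                      lookup (removeAt xs e) (lowerIndex xs e f f≢e) ≡ lookup xs f
  lowerIndex-lookup (x ∷ xs) zero    zero    f≢e = ⊥-elim (f≢e refl)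
  lowerIndex-lookup (x ∷ xs) zero    (suc f) _   = refl
  lowerIndex-lookup (x ∷ xs) (suc e) zero    _   = refl
  lowerIndex-lookup (x ∷ xs) (suc e) (suc f) f≢e = lowerIndex-lookup xs e f (f≢e ∘ cong suc)

joins-transport : ∀ {n} {G H : SignedGraph n} {f g x y} → lookup G f ≡ lookup H g →
                  Joins G f x y → Joins H g x y
joins-transport {x = x} {y} same =
  subst (λ E → (end₁ E ≡ x × end₂ E ≡ y) ⊎ (end₁ E ≡ y × end₂ E ≡ x)) same

module Deletion {n : ℕ} (G : SignedGraph n) (e : EdgeOf G) where

  liftChain : ∀ {x y} → Chain (G ─ e) x y → Chain G x y
  liftChain []           = []
  liftChain (i ∷⟨ j ⟩ w) =
    liftIndex G e i ∷⟨ joins-transport {G = G ─ e} {H = G} (sym (liftIndex-lookup G e i)) j ⟩ liftChain w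

  liftChain-sign : ∀ {x y} (w : Chain (G ─ e) x y) → chainSign (liftChain w) ≡ chainSign w
  liftChain-sign []           = refl
  liftChain-sign (i ∷⟨ _ ⟩ w) = cong₂ _*ₛ_ (cong sgn (liftIndex-lookup G e i)) (liftChain-sign w)

  liftChain-avoids : ∀ {x y} (w : Chain (G ─ e) x y) → e ∉ edges (liftChain w)
  liftChain-avoids (i ∷⟨ _ ⟩ w) (here e≡)    = liftIndex-≢ G e i (sym e≡)
  liftChain-avoids (i ∷⟨ _ ⟩ w) (there e∈w) = liftChain-avoids w e∈w

  lowerChain : ∀ {x y} (w : Chain G x y) → e ∉ edges w → Chain (G ─ e) x y
  lowerChain []           _  = []
  lowerChain (f ∷⟨ j ⟩ w) e∉ =
    lowerIndex G e f f≢e ∷⟨ joins-transport {G = G} {H = G ─ e} (sym (lowerIndex-lookup G e f f≢e)) j ⟩ lowerChain w (e∉ ∘ there)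
    where
      f≢e : f ≢ e
      f≢e f≡e = e∉ (here (sym f≡e))

  lowerChain-sign : ∀ {x y} (w : Chain G x y) (e∉ : e ∉ edges w) → chainSign (lowerChain w e∉) ≡ chainSign w
  lowerChain-sign []           _  = refl
  lowerChain-sign (f ∷⟨ _ ⟩ w) e∉ =
    cong₂ _*ₛ_ (cong sgn (lowerIndex-lookup G e f _)) (lowerChain-sign w (e∉ ∘ there))

open Deletion

signConnected⇒cycle : ∀ {n} (G : SignedGraph n) → 2 ≤ n → SignConnected G → Cycle G
signConnected⇒cycle G 2≤n sc with distinctVertices 2≤n
... | x , y , x≢y with negativeClosedChain G x≢y (sc x y)
...   | W , neg = proj₁ (cycleIn G W neg)

-- If G ─ e is sign connected (G having two vertices), a cycle of G avoids e:
-- a negative closed chain of G ─ e lifts to one of G avoiding e.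
avoidingCycle-deletion : ∀ {n} (G : SignedGraph n) (e : EdgeOf G) → 2 ≤ n → SignConnected (G ─ e) →
                         Σ[ F ∈ Cycle G ] e ∉ edges (walk F)
avoidingCycle-deletion G e 2≤n sc with distinctVertices 2≤n
... | x , y , x≢y with negativeClosedChain (G ─ e) x≢y (sc x y)
...   | W , neg with cycleIn G (liftChain G e W) (trans (liftChain-sign G e W) neg)
...     | F , F⊆W = F , liftChain-avoids G e W ∘ F⊆W

-- If the ends of e are joined in G ─ e, a cycle of G passes through e: the
-- joining chain closed by e is negative under the indicator of e.
cycleThrough-deletion : ∀ {n} (G : SignedGraph n) (e : EdgeOf G) →
                        Chain (G ─ e) (end₂ (lookup G e)) (end₁ (lookup G e)) →
                        Σ[ C ∈ Cycle G ] e ∈ edges (walk C)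
cycleThrough-deletion G e r
  with negativeCycleIn G (indicator G e) closed
         (cong₂ _*ₛ_ (indicator-self G e) (indicator-avoid G e (liftChain G e r) (liftChain-avoids G e r)))
  where closed = e ∷⟨ inj₁ (refl , refl) ⟩ liftChain G e r
... | C , neg , _ = C , indicator-negative⇒∈ G e (walk C) neg

-- (b) In a graph with two vertices and exactly one cycle every edge is a sign
-- isthmus: otherwise the single cycle would both avoid and contain it.
exactlyOneCycle⇒signIsthmus : ∀ {n} (G : SignedGraph n) → 2 ≤ n → ExactlyOneCycle G →
                              ∀ e → SignIsthmus G e
exactlyOneCycle⇒signIsthmus G 2≤n (_ , unique) e sc
  with avoidingCycle-deletion G e 2≤n sc
     | cycleThrough-deletion G e (signConnected⇒chain (G ─ e) (sc _ _))
... | F , e∉F | C , e∈C = e∉F (Equivalence.from (unique F C e) e∈C)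

-- (c) If a negative cycle avoids e, then e is a sign isthmus exactly when it
-- is an isthmus: that cycle survives in G ─ e.
signIsthmus⇔isthmus : ∀ {n} (G : SignedGraph n) (e : EdgeOf G) (F : Cycle G) →
                      e ∉ edges (walk F) → cycleSign F ≡ Sign.- → SignIsthmus G e ⇔ Isthmus G e
signIsthmus⇔isthmus G e F e∉F neg = mk⇔
  (λ notSC conn → notSC (negativeClosedChain⇒signConnected (G ─ e) conn (lowerChain G e (walk F) e∉F)
                                                           (trans (lowerChain-sign G e (walk F) e∉F) neg)))
  (λ notConn sc → notConn λ x y → signConnected⇒chain (G ─ e) (sc x y))

theorem5p4 : ∀ {n : ℕ} (G : SignedGraph n) →
    2 ≤ n → Connected G → NoPositiveCycle G →
    (SignConnected G ⇔ HasCycle G)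
    × (ExactlyOneCycle G → ∀ (e : EdgeOf G) → SignIsthmus G e)
    × (AtLeastTwoCycles G → ∀ (e : EdgeOf G) → (SignIsthmus G e ⇔ Isthmus G e))
theorem5p4 G 2≤n conn noPos =
    mk⇔ (signConnected⇒cycle G 2≤n)
        (λ C → negativeClosedChain⇒signConnected G conn (walk C) (noPos C))
  , exactlyOneCycle⇒signIsthmus G 2≤n
  , λ twoCycles e → let F , e∉F = avoidingCycle G twoCycles e
                     in signIsthmus⇔isthmus G e F e∉F (noPos F)
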